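{- Let ${\bf d}=(d_0,d_1,\ldots)$ be a directive sequence of integers with $d_i\ge 1$ for all $i\ge 0$, with standard words $s_{ -1}=b$, $s_0=a$, $s_{n+1}=s_n^{d_n}s_{n-1}$ for $n\ge 0$, lengths $q_n=|s_n|$ (so $q_{ -1}=q_0=1$, $q_{n+1}=d_nq_n+q_{n-1}$), and let ${\bf s}={\bf s}[1]{\bf s}[2]\cdots=\lim_n s_n$ be the characteristic Sturmian word. Let $0\le p_1\le p_2$ be integers such that ${\bf s}(p_1..p_2]$ is a palindrome. Then there exist an integer $n\ge 0$, a legal representation $p_1=\sum_{i=0}^n x_iq_i$ (with $0\le x_i\le d_i$, leading zeros allowed), an index $m\in\{0,\ldots,n\}$ and an integer $y_m\ge 0$ such that $$p_2=\sum_{i=m+1}^{n}x_iq_i+y_mq_m+\sum_{i=0}^{m-1}(d_i-x_i)q_i$$ is a valid representation of $p_2$, i.e. the prefix ${\bf s}(0..p_2]$ equals $s_n^{x_n}\cdots s_{m+1}^{x_{m+1}}\,s_m^{y_m}\,s_{m-1}^{d_{m-1}-x_{m-1}}\cdots s_0^{d_0-x_0}$.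
   Context: ${\bf s}(i..j]$ denotes ${\bf s}[i+1]\cdots{\bf s}[j]$ (indices of ${\bf s}$ start at $1$). A palindrome is a word equal to its reversal. A decomposition $N=\sum_{0\le i\le n}k_iq_i$ with integers $k_i\ge 0$ is called legal if $0\le k_i\le d_i$ for all $i$; it is called valid if the prefix of length $N$ of ${\bf s}$ equals $s_n^{k_n}s_{n-1}^{k_{n-1}}\cdots s_0^{k_0}$. -}

module Defs where

open import Data.Nat using (ℕ; zero; suc; _+_; _*_)
open import Data.List using (List; []; _∷_; _++_; length; reverse; map; drop)
open import Data.Product using (_×_; _,_; proj₁; proj₂)

data Letter : Set where
  a b : Letter

pow : List Letter → ℕ → List Letter
pow w zero    = []
pow w (suc k) = w ++ pow w k

-- stdPair d n = (s_n , s_{n-1}), with s_{-1} = b, s_0 = a,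
-- s_{n+1} = s_n^{d_n} s_{n-1}.
stdPair : (ℕ → ℕ) → ℕ → List Letter × List Letter
stdPair d zero    = (a ∷ []) , (b ∷ [])
stdPair d (suc n) = (pow (proj₁ (stdPair d n)) (d n) ++ proj₂ (stdPair d n)) , proj₁ (stdPair d n)

std : (ℕ → ℕ) → ℕ → List Letter
std d n = proj₁ (stdPair d n)

q : (ℕ → ℕ) → ℕ → ℕ
q d n = length (std d n)

-- An infinite word is a function w : ℕ → Letter; w i is the letter s[i+1]
-- (0-based storage of the 1-based word).
-- Prefix of length N:  s(0..N] = w 0 ... w (N-1).
prefix : (ℕ → Letter) → ℕ → List Letter
prefix w zero    = []
prefix w (suc N) = prefix w N ++ (w N ∷ [])

-- Factor s(i..j] = s[i+1] ... s[j]
factor : (ℕ → Letter) → ℕ → ℕ → List Letter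
factor w i j = drop i (prefix w j)

IsPalindrome : List Letter → Set
IsPalindrome u = reverse u ≡ u
  where open import Relation.Binary.PropositionalEquality using (_≡_)

IsCharWord : (ℕ → ℕ) → (ℕ → Letter) → Set
IsCharWord d w = ∀ n → prefix w (q d n) ≡ std d n
  where open import Relation.Binary.PropositionalEquality using (_≡_)

sumFrom : (ℕ → ℕ) → ℕ → ℕ → ℕ
sumFrom f lo zero    = 0
sumFrom f lo (suc k) = f (lo + k) + sumFrom f lo k

catDown : (ℕ → List Letter) → ℕ → ℕ → List Letter
catDown f lo zero    = []
catDown f lo (suc k) = f (lo + k) ++ catDown f lo k

-- With φₖ(a) = aᵏb and φₖ(b) = a one has s_{n+1}(d) = φ_{d₀}(s_n(d′)) for the shifted sequence d′,
-- so w = φ_{d₀}(w′) for the characteristic word w′ of d′, and every b of w closes a block a^{d₀}b.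
-- Locating the first and, by symmetry, the last b of a palindrome w(p₁..p₂] in these blocks gives
-- p₁ = Φ P₁ + x₀ and p₂ = Φ P₂ + (d₀ − x₀), where Φ P = |φ_{d₀}(w′(0..P])|. As φ_{d₀}(v) a^{d₀} is a
-- palindrome only if v is (φ and its mirror image ψ are conjugate by a^{d₀}), w′(P₁..P₂] is a
-- palindrome, and induction on p₂ yields the decomposition over d′. Applying φ_{d₀} moves every digit
-- one level up and contributes x₀ and d₀ − x₀ as the new lowest digits. Only when p₁ and p₂ both lie
-- in the run a^{d₀} following one Φ P is the decomposition built directly, with m = 0.
module Submission where

open import Defs
open import Data.Nat using (ℕ; zero; suc; _+_; _*_; _∸_; _≤_; _≥_; _<_; z≤n; s≤s; s≤s⁻¹; _≤?_)
open import Data.Nat.Properties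
open import Data.Nat.Induction using (<-rec)
open import Data.List using (List; []; _∷_; _++_; length; reverse; drop; take; concatMap)
open import Data.List.Properties
  using (++-assoc; ++-identityʳ; ++-cancelˡ; ++-cancelʳ; length-++; length-drop; take-all;
         reverse-++; unfold-reverse; reverse-involutive; length-reverse; concatMap-++; drop-all)
open import Data.Product using (Σ; _×_; _,_; proj₁; proj₂)
open import Data.Sum using (_⊎_; inj₁; inj₂)
open import Data.Empty using (⊥-elim)
open import Relation.Nullary using (yes; no)
open import Relation.Binary.PropositionalEquality
  using (_≡_; _≢_; refl; sym; trans; cong; cong₂; subst; subst₂; module ≡-Reasoning)
open ≡-Reasoning

b≢a : b ≢ a
b≢a ()

-- Lookup with a junk default a; it is only used within range.
at : List Letter → ℕ → Letter
at []      _       = a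
at (c ∷ u) zero    = c
at (c ∷ u) (suc j) = at u j

at-++ˡ : ∀ (u v : List Letter) {j} → j < length u → at (u ++ v) j ≡ at u j
at-++ˡ (c ∷ u) v {zero}  _   = refl
at-++ˡ (c ∷ u) v {suc j} j<u = at-++ˡ u v (s≤s⁻¹ j<u)

at-++ʳ : ∀ (u v : List Letter) t → at (u ++ v) (length u + t) ≡ at v t
at-++ʳ []      v t = refl
at-++ʳ (c ∷ u) v t = at-++ʳ u v t

at-drop : ∀ n (u : List Letter) t → at (drop n u) t ≡ at u (n + t)
at-drop zero    u       t = refl
at-drop (suc n) []      t = refl
at-drop (suc n) (c ∷ u) t = at-drop n u t

drop-length-++ : ∀ (u v : List Letter) → drop (length u) (u ++ v) ≡ v
drop-length-++ []      v = refl
drop-length-++ (c ∷ u) v = drop-length-++ u v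

take-suc-at : ∀ (u : List Letter) n → n < length u → take (suc n) u ≡ take n u ++ at u n ∷ []
take-suc-at (c ∷ u) zero    _   = refl
take-suc-at (c ∷ u) (suc n) n<u = cong (c ∷_) (take-suc-at u n (s≤s⁻¹ n<u))

pow-+ : ∀ u j k → pow u (j + k) ≡ pow u j ++ pow u k
pow-+ u zero    k = refl
pow-+ u (suc j) k = trans (cong (u ++_) (pow-+ u j k)) (sym (++-assoc u (pow u j) (pow u k)))

pow-suc : ∀ u k → pow u (suc k) ≡ pow u k ++ u
pow-suc u k = begin
  pow u (suc k)        ≡⟨ cong (pow u) (+-comm 1 k) ⟩
  pow u (k + 1)        ≡⟨ pow-+ u k 1 ⟩
  pow u k ++ u ++ []   ≡⟨ cong (pow u k ++_) (++-identityʳ u) ⟩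
  pow u k ++ u         ∎

length-pow : ∀ u k → length (pow u k) ≡ k * length u
length-pow u zero    = refl
length-pow u (suc k) = trans (length-++ u) (cong (length u +_) (length-pow u k))

a^ : ℕ → List Letter
a^ k = pow (a ∷ []) k

length-a^ : ∀ k → length (a^ k) ≡ k
length-a^ k = trans (length-pow (a ∷ []) k) (*-identityʳ k)

reverse-a^ : ∀ k → reverse (a^ k) ≡ a^ k
reverse-a^ zero    = refl
reverse-a^ (suc k) = begin
  reverse (a ∷ a^ k)      ≡⟨ unfold-reverse a (a^ k) ⟩
  reverse (a^ k) ++ a ∷ [] ≡⟨ cong (_++ a ∷ []) (reverse-a^ k) ⟩
  a^ k ++ a ∷ []          ≡⟨ sym (pow-suc (a ∷ []) k) ⟩
  a^ (suc k)              ∎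

at-a^ : ∀ k {t} → t < k → at (a^ k) t ≡ a
at-a^ (suc k) {zero}  _   = refl
at-a^ (suc k) {suc t} t<k = at-a^ k (s≤s⁻¹ t<k)

split-at-first-b : ∀ u → (Σ ℕ λ k → u ≡ a^ k) ⊎ (Σ ℕ λ i → Σ (List Letter) λ v → u ≡ a^ i ++ b ∷ v)
split-at-first-b []      = inj₁ (0 , refl)
split-at-first-b (b ∷ u) = inj₂ (0 , u , refl)
split-at-first-b (a ∷ u) with split-at-first-b u
... | inj₁ (k , u≡)     = inj₁ (suc k , cong (a ∷_) u≡)
... | inj₂ (i , v , u≡) = inj₂ (suc i , v , cong (a ∷_) u≡)

palindrome-wrap : ∀ v u → reverse v ≡ v → IsPalindrome u → IsPalindrome (v ++ u ++ v)
palindrome-wrap v u rev-v pal-u = begin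
  reverse (v ++ u ++ v)                   ≡⟨ reverse-++ v (u ++ v) ⟩
  reverse (u ++ v) ++ reverse v           ≡⟨ cong (_++ reverse v) (reverse-++ u v) ⟩
  (reverse v ++ reverse u) ++ reverse v   ≡⟨ cong₂ _++_ (cong₂ _++_ rev-v pal-u) rev-v ⟩
  (v ++ u) ++ v                           ≡⟨ ++-assoc v u v ⟩
  v ++ u ++ v                             ∎

m<n∸o⇒o+m<n : ∀ o {m n} → m < n ∸ o → o + m < n
m<n∸o⇒o+m<n zero              m<n = m<n
m<n∸o⇒o+m<n (suc o) {n = suc n} m<n = s≤s (m<n∸o⇒o+m<n o m<n)

module _ (w : ℕ → Letter) where

  length-prefix : ∀ n → length (prefix w n) ≡ n
  length-prefix zero    = refl
  length-prefix (suc n) = trans (length-++ (prefix w n)) (trans (cong (_+ 1) (length-prefix n)) (+-comm n 1))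

  at-prefix : ∀ n {k} → k < n → at (prefix w n) k ≡ w k
  at-prefix (suc n) {k} k<1+n with m≤n⇒m<n∨m≡n (s≤s⁻¹ k<1+n)
  ... | inj₁ k<n  = trans (at-++ˡ (prefix w n) _ (subst (k <_) (sym (length-prefix n)) k<n)) (at-prefix n k<n)
  ... | inj₂ refl = begin
    at (prefix w k ++ w k ∷ []) k
      ≡⟨ cong (at (prefix w k ++ w k ∷ [])) (sym (trans (+-identityʳ _) (length-prefix k))) ⟩
    at (prefix w k ++ w k ∷ []) (length (prefix w k) + 0)
      ≡⟨ at-++ʳ (prefix w k) _ 0 ⟩
    w k ∎

  prefix-letters : ∀ u → (∀ k → k < length u → w k ≡ at u k) → prefix w (length u) ≡ u
  prefix-letters u letters = trans (prefix≡take (length u) ≤-refl) (take-all (length u) u ≤-refl)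
    where
    prefix≡take : ∀ n → n ≤ length u → prefix w n ≡ take n u
    prefix≡take zero    _   = refl
    prefix≡take (suc n) n<u = begin
      prefix w n ++ w n ∷ []    ≡⟨ cong₂ (λ v c → v ++ c ∷ []) (prefix≡take n (<⇒≤ n<u)) (letters n n<u) ⟩
      take n u ++ at u n ∷ []   ≡⟨ sym (take-suc-at u n n<u) ⟩
      take (suc n) u            ∎

  prefix-of-prefix : ∀ n u v → prefix w n ≡ u ++ v → prefix w (length u) ≡ u
  prefix-of-prefix n u v eq = prefix-letters u letters
    where
    letters : ∀ k → k < length u → w k ≡ at u k
    letters k k<u = begin
      w k                 ≡⟨ sym (at-prefix n (≤-trans k<u u≤n)) ⟩
      at (prefix w n) k   ≡⟨ cong (λ z → at z k) eq ⟩
      at (u ++ v) k       ≡⟨ at-++ˡ u v k<u ⟩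
      at u k              ∎
      where
      u≤n : length u ≤ n
      u≤n = subst (length u ≤_) (trans (sym (length-++ u)) (trans (cong length (sym eq)) (length-prefix n)))
                  (m≤m+n (length u) (length v))

  prefix-extends : ∀ {m n} → m ≤ n → Σ (List Letter) λ v → prefix w n ≡ prefix w m ++ v
  prefix-extends {m} {zero}  z≤n = [] , refl
  prefix-extends {m} {suc n} m≤n with m≤n⇒m<n∨m≡n m≤n
  ... | inj₂ refl = [] , sym (++-identityʳ _)
  ... | inj₁ m<n with prefix-extends (s≤s⁻¹ m<n)
  ... | v , eq = v ++ w n ∷ [] , trans (cong (_++ w n ∷ []) eq) (++-assoc (prefix w m) v _)

  prefix-++-factor : ∀ {m n} → m ≤ n → prefix w n ≡ prefix w m ++ factor w m n
  prefix-++-factor {m} {n} m≤n with prefix-extends m≤n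
  ... | v , eq = trans eq (cong (prefix w m ++_) (sym factor≡v))
    where
    factor≡v : factor w m n ≡ v
    factor≡v = begin
      drop m (prefix w n)                                   ≡⟨ cong (drop m) eq ⟩
      drop m (prefix w m ++ v)                              ≡⟨ cong (λ k → drop k (prefix w m ++ v)) (sym (length-prefix m)) ⟩
      drop (length (prefix w m)) (prefix w m ++ v)          ≡⟨ drop-length-++ (prefix w m) v ⟩
      v                                                     ∎

  factor-self : ∀ p → factor w p p ≡ []
  factor-self p = drop-all p (prefix w p) (≤-reflexive (length-prefix p))

  length-factor : ∀ p q → length (factor w p q) ≡ q ∸ p
  length-factor p q = trans (length-drop p (prefix w q)) (cong (_∸ p) (length-prefix q))

  at-factor : ∀ p q {t} → t < length (factor w p q) → at (factor w p q) t ≡ w (p + t)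
  at-factor p q {t} t<u = trans (at-drop p (prefix w q) t)
    (at-prefix q (m<n∸o⇒o+m<n p (subst (t <_) (length-factor p q) t<u)))

  letter-of-factor : ∀ {p q k c} u v → factor w p q ≡ u ++ c ∷ v → p + length u ≡ k → w k ≡ c
  letter-of-factor {p} {q} {k} {c} u v eq refl = begin
    w (p + length u)                ≡⟨ sym (at-factor p q u<factor) ⟩
    at (factor w p q) (length u)    ≡⟨ cong (λ z → at z (length u)) eq ⟩
    at (u ++ c ∷ v) (length u)      ≡⟨ at-++-length u ⟩
    c                               ∎
    where
    at-++-length : ∀ u → at (u ++ c ∷ v) (length u) ≡ c
    at-++-length []      = refl
    at-++-length (_ ∷ u) = at-++-length u
    u<factor : length u < length (factor w p q)
    u<factor = subst (length u <_) (trans (sym (length-++ u)) (cong length (sym eq))) (m<m+n (length u) (s≤s z≤n))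

  aRun : ℕ → ℕ → Set
  aRun p q = ∀ k → p ≤ k → k < q → w k ≡ a

  NextB : ℕ → ℕ → Set
  NextB p k = p ≤ k × aRun p k × w k ≡ b

  aRun-bound : ∀ {p q k} → aRun p q → p ≤ k → w k ≡ b → q ≤ k
  aRun-bound run p≤k wk≡b = ≮⇒≥ λ k<q → b≢a (trans (sym wk≡b) (run _ p≤k k<q))

  nextB-unique : ∀ {p k l} → NextB p k → NextB p l → k ≡ l
  nextB-unique (p≤k , run-k , wk) (p≤l , run-l , wl) = ≤-antisym (aRun-bound run-k p≤l wl) (aRun-bound run-l p≤k wk)

  nextB-later : ∀ {p p′ k} → p ≤ p′ → p′ ≤ k → NextB p k → NextB p′ k
  nextB-later p≤p′ p′≤k (_ , run , wk) = p′≤k , (λ j p′≤j j<k → run j (≤-trans p≤p′ p′≤j) j<k) , wk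

  aRun-of-factor : ∀ {p q s e L} u v → factor w p q ≡ u ++ a^ L ++ v → p + length u ≡ s → s + L ≡ e → aRun s e
  aRun-of-factor {p} {q} {L = L} u v eq refl refl k s≤k k<e = letter-of-factor {p} {q} (u ++ a^ j) (a^ (L ∸ suc j) ++ v) eq′ position
    where
    s = p + length u
    j = k ∸ s
    k≡s+j : k ≡ s + j
    k≡s+j = sym (m+[n∸m]≡n s≤k)
    j<L : j < L
    j<L = +-cancelˡ-< s j L (subst (_< s + L) k≡s+j k<e)
    a^L : a^ L ≡ a^ j ++ a ∷ a^ (L ∸ suc j)
    a^L = trans (cong a^ (sym (m+[n∸m]≡n (<⇒≤ j<L)))) (trans (cong (λ n → a^ (j + n)) (+-∸-assoc 1 j<L))
            (pow-+ (a ∷ []) j (suc (L ∸ suc j))))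
    eq′ : factor w p q ≡ (u ++ a^ j) ++ a ∷ a^ (L ∸ suc j) ++ v
    eq′ = begin
      factor w p q                                  ≡⟨ eq ⟩
      u ++ a^ L ++ v                                ≡⟨ cong (λ z → u ++ z ++ v) a^L ⟩
      u ++ (a^ j ++ a ∷ a^ (L ∸ suc j)) ++ v        ≡⟨ cong (u ++_) (++-assoc (a^ j) _ v) ⟩
      u ++ a^ j ++ a ∷ a^ (L ∸ suc j) ++ v          ≡⟨ sym (++-assoc u (a^ j) _) ⟩
      (u ++ a^ j) ++ a ∷ a^ (L ∸ suc j) ++ v        ∎
    position : p + length (u ++ a^ j) ≡ k
    position = begin
      p + length (u ++ a^ j)        ≡⟨ cong (p +_) (trans (length-++ u) (cong (length u +_) (length-a^ j))) ⟩
      p + (length u + j)            ≡⟨ sym (+-assoc p (length u) j) ⟩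
      s + j                         ≡⟨ sym k≡s+j ⟩
      k                             ∎

  prefix-run : ∀ u g → prefix w (length u + suc g) ≡ u ++ a^ g ++ b ∷ [] →
               NextB (length u) (length u + g) × (∀ j → j ≤ g → prefix w (length u + j) ≡ u ++ a^ j)
  prefix-run u g eq = (m≤m+n (length u) g , aRun-of-factor {0} {length u + suc g} u (b ∷ []) eq refl refl , last-b) , shorter
    where
    last-b : w (length u + g) ≡ b
    last-b = letter-of-factor {0} {length u + suc g} (u ++ a^ g) [] (trans eq (sym (++-assoc u (a^ g) (b ∷ []))))
               (trans (length-++ u) (cong (length u +_) (length-a^ g)))
    shorter : ∀ j → j ≤ g → prefix w (length u + j) ≡ u ++ a^ j
    shorter j j≤g = subst (λ n → prefix w n ≡ u ++ a^ j) (trans (length-++ u) (cong (length u +_) (length-a^ j)))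
      (prefix-of-prefix (length u + suc g) (u ++ a^ j) (a^ (g ∸ j) ++ b ∷ []) (begin
        prefix w (length u + suc g)                 ≡⟨ eq ⟩
        u ++ a^ g ++ b ∷ []                         ≡⟨ cong (λ n → u ++ a^ n ++ b ∷ []) (sym (m+[n∸m]≡n j≤g)) ⟩
        u ++ a^ (j + (g ∸ j)) ++ b ∷ []             ≡⟨ cong (λ v → u ++ v ++ b ∷ []) (pow-+ (a ∷ []) j (g ∸ j)) ⟩
        u ++ (a^ j ++ a^ (g ∸ j)) ++ b ∷ []         ≡⟨ cong (u ++_) (++-assoc (a^ j) (a^ (g ∸ j)) (b ∷ [])) ⟩
        u ++ a^ j ++ a^ (g ∸ j) ++ b ∷ []           ≡⟨ sym (++-assoc u (a^ j) _) ⟩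
        (u ++ a^ j) ++ a^ (g ∸ j) ++ b ∷ []         ∎))

-- Standard words and the morphisms φₖ

stdPrev : (ℕ → ℕ) → ℕ → List Letter
stdPrev d n = proj₂ (stdPair d n)

module StandardWords (d : ℕ → ℕ) (d≥1 : ∀ i → d i ≥ 1) where

  std-suc : ∀ n → std d (suc n) ≡ std d n ++ pow (std d n) (d n ∸ 1) ++ stdPrev d n
  std-suc n = begin
    pow (std d n) (d n) ++ stdPrev d n                   ≡⟨ cong (λ k → pow (std d n) k ++ stdPrev d n) (sym (m+[n∸m]≡n (d≥1 n))) ⟩
    (std d n ++ pow (std d n) (d n ∸ 1)) ++ stdPrev d n  ≡⟨ ++-assoc (std d n) _ _ ⟩
    std d n ++ pow (std d n) (d n ∸ 1) ++ stdPrev d n    ∎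

  n<q : ∀ n → n < q d n
  stdPrev-nonempty : ∀ n → 1 ≤ length (stdPrev d n)

  n<q zero    = s≤s z≤n
  n<q (suc n) = subst (suc (suc n) ≤_) (sym q-suc)
    (≤-trans (≤-reflexive (+-comm 1 (suc n))) (+-mono-≤ (n<q n) (≤-trans (stdPrev-nonempty n) (m≤n+m _ _))))
    where
    q-suc : q d (suc n) ≡ q d n + (length (pow (std d n) (d n ∸ 1)) + length (stdPrev d n))
    q-suc = trans (cong length (std-suc n))
      (trans (length-++ (std d n)) (cong (q d n +_) (length-++ (pow (std d n) (d n ∸ 1)))))

  stdPrev-nonempty zero    = s≤s z≤n
  stdPrev-nonempty (suc n) = ≤-trans (s≤s z≤n) (n<q n)

  std-extends : ∀ {m n} → m ≤ n → Σ (List Letter) λ v → std d n ≡ std d m ++ v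
  std-extends {m} {zero}  z≤n = [] , refl
  std-extends {m} {suc n} m≤n with m≤n⇒m<n∨m≡n m≤n
  ... | inj₂ refl = [] , sym (++-identityʳ _)
  ... | inj₁ m<n with std-extends (s≤s⁻¹ m<n)
  ... | v , eq = v ++ rest , trans (std-suc n) (trans (cong (_++ rest) eq) (++-assoc (std d m) v rest))
    where rest = pow (std d n) (d n ∸ 1) ++ stdPrev d n

φ-letter : ℕ → Letter → List Letter
φ-letter k a = a^ k ++ b ∷ []
φ-letter k b = a ∷ []

φ : ℕ → List Letter → List Letter
φ k = concatMap (φ-letter k)

φ-++ : ∀ k u v → φ k (u ++ v) ≡ φ k u ++ φ k v
φ-++ k = concatMap-++ (φ-letter k)

φ-pow : ∀ k u j → φ k (pow u j) ≡ pow (φ k u) j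
φ-pow k u zero    = refl
φ-pow k u (suc j) = trans (φ-++ k u (pow u j)) (cong (φ k u ++_) (φ-pow k u j))

shift : (ℕ → ℕ) → ℕ → ℕ
shift d i = d (suc i)

φ-stdPair : ∀ d n → φ (d 0) (std (shift d) n) ≡ std d (suc n) × φ (d 0) (stdPrev (shift d) n) ≡ stdPrev d (suc n)
φ-stdPair d zero    = ++-identityʳ _ , refl
φ-stdPair d (suc n) with φ-stdPair d n
... | φ-s , φ-s′ = step , φ-s
  where
  step : φ (d 0) (pow (std (shift d) n) (d (suc n)) ++ stdPrev (shift d) n) ≡ std d (suc (suc n))
  step = begin
    φ (d 0) (pow (std (shift d) n) (d (suc n)) ++ stdPrev (shift d) n)
      ≡⟨ φ-++ (d 0) (pow (std (shift d) n) (d (suc n))) _ ⟩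
    φ (d 0) (pow (std (shift d) n) (d (suc n))) ++ φ (d 0) (stdPrev (shift d) n)
      ≡⟨ cong₂ _++_ (trans (φ-pow (d 0) _ (d (suc n))) (cong (λ u → pow u (d (suc n))) φ-s)) φ-s′ ⟩
    std d (suc (suc n)) ∎

φ-std : ∀ d n → φ (d 0) (std (shift d) n) ≡ std d (suc n)
φ-std d n = proj₁ (φ-stdPair d n)

φ-pow-std : ∀ d i k → φ (d 0) (pow (std (shift d) i) k) ≡ pow (std d (suc i)) k
φ-pow-std d i k = trans (φ-pow (d 0) (std (shift d) i) k) (cong (λ u → pow u k) (φ-std d i))

ψ-letter : ℕ → Letter → List Letter
ψ-letter k a = b ∷ a^ k
ψ-letter k b = a ∷ []

ψ : ℕ → List Letter → List Letter
ψ k = concatMap (ψ-letter k)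

reverse-φ : ∀ k u → reverse (φ k u) ≡ ψ k (reverse u)
reverse-φ k []      = refl
reverse-φ k (c ∷ u) = begin
  reverse (φ-letter k c ++ φ k u)                 ≡⟨ reverse-++ (φ-letter k c) (φ k u) ⟩
  reverse (φ k u) ++ reverse (φ-letter k c)       ≡⟨ cong₂ _++_ (reverse-φ k u) (reverse-φ-letter c) ⟩
  ψ k (reverse u) ++ ψ-letter k c                 ≡⟨ cong (ψ k (reverse u) ++_) (sym (++-identityʳ _)) ⟩
  ψ k (reverse u) ++ ψ k (c ∷ [])                 ≡⟨ sym (concatMap-++ (ψ-letter k) (reverse u) (c ∷ [])) ⟩
  ψ k (reverse u ++ c ∷ [])                       ≡⟨ cong (ψ k) (sym (unfold-reverse c u)) ⟩
  ψ k (reverse (c ∷ u))                           ∎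
  where
  reverse-φ-letter : ∀ c → reverse (φ-letter k c) ≡ ψ-letter k c
  reverse-φ-letter a = trans (reverse-++ (a^ k) (b ∷ [])) (cong (b ∷_) (reverse-a^ k))
  reverse-φ-letter b = refl

-- {b aᵏ, a} is a prefix code.
ψ-injective : ∀ k u v → ψ k u ≡ ψ k v → u ≡ v
ψ-injective k []      []      _  = refl
ψ-injective k (a ∷ u) (a ∷ v) eq = cong (a ∷_) (ψ-injective k u v (++-cancelˡ (b ∷ a^ k) (ψ k u) (ψ k v) eq))
ψ-injective k (b ∷ u) (b ∷ v) eq = cong (b ∷_) (ψ-injective k u v (++-cancelˡ (a ∷ []) (ψ k u) (ψ k v) eq))
ψ-injective k []      (a ∷ v) ()
ψ-injective k []      (b ∷ v) ()
ψ-injective k (a ∷ u) []      ()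
ψ-injective k (b ∷ u) []      ()
ψ-injective k (a ∷ u) (b ∷ v) ()
ψ-injective k (b ∷ u) (a ∷ v) ()

φ-injective : ∀ k u v → φ k u ≡ φ k v → u ≡ v
φ-injective k u v eq = begin
  u
    ≡⟨ sym (reverse-involutive u) ⟩
  reverse (reverse u)
    ≡⟨ cong reverse (ψ-injective k (reverse u) (reverse v) (trans (sym (reverse-φ k u)) (trans (cong reverse eq) (reverse-φ k v)))) ⟩
  reverse (reverse v)
    ≡⟨ reverse-involutive v ⟩
  v ∎

φ-++-a^-conjugate : ∀ k u → φ k u ++ a^ k ≡ a^ k ++ ψ k u
φ-++-a^-conjugate k []      = sym (++-identityʳ _)
φ-++-a^-conjugate k (c ∷ u) = begin
  (φ-letter k c ++ φ k u) ++ a^ k        ≡⟨ ++-assoc (φ-letter k c) (φ k u) (a^ k) ⟩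
  φ-letter k c ++ φ k u ++ a^ k          ≡⟨ cong (φ-letter k c ++_) (φ-++-a^-conjugate k u) ⟩
  φ-letter k c ++ a^ k ++ ψ k u          ≡⟨ sym (++-assoc (φ-letter k c) (a^ k) (ψ k u)) ⟩
  (φ-letter k c ++ a^ k) ++ ψ k u        ≡⟨ cong (_++ ψ k u) (letter c) ⟩
  (a^ k ++ ψ-letter k c) ++ ψ k u        ≡⟨ ++-assoc (a^ k) (ψ-letter k c) (ψ k u) ⟩
  a^ k ++ ψ k (c ∷ u)                    ∎
  where
  letter : ∀ c → φ-letter k c ++ a^ k ≡ a^ k ++ ψ-letter k c
  letter a = ++-assoc (a^ k) (b ∷ []) (a^ k)
  letter b = pow-suc (a ∷ []) k

palindrome-of-φ : ∀ k v → IsPalindrome (φ k v ++ a^ k) → IsPalindrome v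
palindrome-of-φ k v pal = φ-injective k (reverse v) v (++-cancelʳ (a^ k) (φ k (reverse v)) (φ k v) (begin
  φ k (reverse v) ++ a^ k         ≡⟨ φ-++-a^-conjugate k (reverse v) ⟩
  a^ k ++ ψ k (reverse v)         ≡⟨ cong₂ _++_ (sym (reverse-a^ k)) (sym (reverse-φ k v)) ⟩
  reverse (a^ k) ++ reverse (φ k v) ≡⟨ sym (reverse-++ (φ k v) (a^ k)) ⟩
  reverse (φ k v ++ a^ k)         ≡⟨ pal ⟩
  φ k v ++ a^ k                   ∎))

-- Digit representations

blocks : (ℕ → ℕ) → (ℕ → ℕ) → ℕ → List Letter
blocks d x i = pow (std d i) (x i)

Legal : (ℕ → ℕ) → ℕ → (ℕ → ℕ) → Set
Legal d n x = ∀ i → i ≤ n → x i ≤ d i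

Represents : (ℕ → ℕ) → (ℕ → Letter) → ℕ → ℕ → (ℕ → ℕ) → Set
Represents d w p n x = Legal d n x × prefix w p ≡ catDown (blocks d x) 0 (suc n)

ComplementaryRep : (ℕ → ℕ) → (ℕ → Letter) → ℕ → ℕ → Set
ComplementaryRep d w p₁ p₂ = Σ ℕ λ n → Σ (ℕ → ℕ) λ x → Represents d w p₁ n x ×
  Σ ℕ λ m → Σ ℕ λ y → m ≤ n ×
    prefix w p₂ ≡ catDown (blocks d x) (suc m) (n ∸ m) ++ pow (std d m) y ++ catDown (blocks d (λ i → d i ∸ x i)) 0 m

prepend : ℕ → (ℕ → ℕ) → ℕ → ℕ
prepend x₀ x zero    = x₀
prepend x₀ x (suc i) = x i

legal-prepend : ∀ {d n x₀ x} → x₀ ≤ d 0 → Legal (shift d) n x → Legal d (suc n) (prepend x₀ x)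
legal-prepend x₀≤ legal zero    _       = x₀≤
legal-prepend x₀≤ legal (suc i) (s≤s i≤n) = legal i i≤n

catDown-from-0 : ∀ f n → catDown f 0 (suc n) ≡ catDown f 1 n ++ f 0
catDown-from-0 f zero    = ++-identityʳ (f 0)
catDown-from-0 f (suc n) = trans (cong (f (suc n) ++_) (catDown-from-0 f n)) (sym (++-assoc (f (suc n)) _ (f 0)))

φ-catDown-blocks : ∀ d (x : ℕ → ℕ) lo n →
  φ (d 0) (catDown (blocks (shift d) (λ i → x (suc i))) lo n) ≡ catDown (blocks d x) (suc lo) n
φ-catDown-blocks d x lo zero    = refl
φ-catDown-blocks d x lo (suc n) = begin
  φ (d 0) (blocks (shift d) (λ i → x (suc i)) (lo + n) ++ catDown (blocks (shift d) (λ i → x (suc i))) lo n)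
    ≡⟨ φ-++ (d 0) (blocks (shift d) (λ i → x (suc i)) (lo + n)) _ ⟩
  φ (d 0) (pow (std (shift d) (lo + n)) (x (suc (lo + n)))) ++ φ (d 0) (catDown (blocks (shift d) (λ i → x (suc i))) lo n)
    ≡⟨ cong₂ _++_ (φ-pow-std d (lo + n) (x (suc (lo + n)))) (φ-catDown-blocks d x lo n) ⟩
  catDown (blocks d x) (suc lo) (suc n) ∎

-- Desubstitution of the characteristic word

module Blocks (d : ℕ → ℕ) (d≥1 : ∀ i → d i ≥ 1) (w : ℕ → Letter) (w-char : IsCharWord d w) where

  d₀ : ℕ
  d₀ = d 0

  d′ : ℕ → ℕ
  d′ = shift d

  d′≥1 : ∀ i → d′ i ≥ 1
  d′≥1 i = d≥1 (suc i)

  open StandardWords d′ d′≥1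

  w′ : ℕ → Letter
  w′ k = at (std d′ (suc k)) k

  w′-char : IsCharWord d′ w′
  w′-char n = prefix-letters w′ (std d′ n) agrees
    where
    agrees : ∀ k → k < q d′ n → w′ k ≡ at (std d′ n) k
    agrees k k<q with ≤-total n (suc k)
    ... | inj₁ n≤1+k with std-extends n≤1+k
    ...   | v , eq = trans (cong (λ u → at u k) eq) (at-++ˡ (std d′ n) v k<q)
    agrees k k<q | inj₂ 1+k≤n with std-extends 1+k≤n
    ...   | v , eq = sym (trans (cong (λ u → at u k) eq) (at-++ˡ (std d′ (suc k)) v (≤-trans (n≤1+n (suc k)) (n<q (suc k)))))

  w′-0 : w′ 0 ≡ a
  w′-0 = cong (λ u → at u 0) (w′-char 0)

  -- Φ P is where the image of w′(P) starts in w = φ_{d₀}(w′).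
  Φ : ℕ → ℕ
  Φ P = length (φ d₀ (prefix w′ P))

  prefix-Φ : ∀ P → prefix w (Φ P) ≡ φ d₀ (prefix w′ P)
  prefix-Φ P with prefix-extends w′ (<⇒≤ (n<q P))
  ... | v , eq = prefix-of-prefix w (q d (suc P)) (φ d₀ (prefix w′ P)) (φ d₀ v) (begin
    prefix w (q d (suc P))                   ≡⟨ w-char (suc P) ⟩
    std d (suc P)                            ≡⟨ sym (φ-std d P) ⟩
    φ d₀ (std d′ P)                          ≡⟨ cong (φ d₀) (trans (sym (w′-char P)) eq) ⟩
    φ d₀ (prefix w′ P ++ v)                  ≡⟨ φ-++ d₀ (prefix w′ P) v ⟩
    φ d₀ (prefix w′ P) ++ φ d₀ v             ∎)

  φ-prefix-suc : ∀ P → φ d₀ (prefix w′ (suc P)) ≡ φ d₀ (prefix w′ P) ++ φ-letter d₀ (w′ P)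
  φ-prefix-suc P = trans (φ-++ d₀ (prefix w′ P) (w′ P ∷ [])) (cong (φ d₀ (prefix w′ P) ++_) (++-identityʳ _))

  Φ-suc : ∀ P → Φ (suc P) ≡ Φ P + length (φ-letter d₀ (w′ P))
  Φ-suc P = trans (cong length (φ-prefix-suc P)) (length-++ (φ d₀ (prefix w′ P)))

  length-φ-letter-a : length (φ-letter d₀ a) ≡ suc d₀
  length-φ-letter-a = trans (length-++ (a^ d₀)) (trans (cong (_+ 1) (length-a^ d₀)) (+-comm d₀ 1))

  φ-letter-nonempty : ∀ c → 0 < length (φ-letter d₀ c)
  φ-letter-nonempty a = subst (0 <_) (sym length-φ-letter-a) (s≤s z≤n)
  φ-letter-nonempty b = s≤s z≤n

  φ-letter-starts-with-a : ∀ c → at (φ-letter d₀ c) 0 ≡ a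
  φ-letter-starts-with-a c with d₀ | d≥1 0
  φ-letter-starts-with-a a | suc _ | _ = refl
  φ-letter-starts-with-a b | suc _ | _ = refl

  letter-in-block : ∀ P {t} → t < length (φ-letter d₀ (w′ P)) → w (Φ P + t) ≡ at (φ-letter d₀ (w′ P)) t
  letter-in-block P {t} t<ℓ = begin
    w (Φ P + t)
      ≡⟨ sym (at-prefix w (Φ (suc P)) (subst (Φ P + t <_) (sym (Φ-suc P)) (+-monoʳ-< (Φ P) t<ℓ))) ⟩
    at (prefix w (Φ (suc P))) (Φ P + t)
      ≡⟨ cong (λ u → at u (Φ P + t)) (trans (prefix-Φ (suc P)) (φ-prefix-suc P)) ⟩
    at (φ d₀ (prefix w′ P) ++ φ-letter d₀ (w′ P)) (Φ P + t)
      ≡⟨ at-++ʳ (φ d₀ (prefix w′ P)) _ t ⟩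
    at (φ-letter d₀ (w′ P)) t ∎

  coordinates : ∀ k → Σ ℕ λ P → Σ ℕ λ e → k ≡ Φ P + e × e < length (φ-letter d₀ (w′ P))
  coordinates zero    = 0 , 0 , refl , φ-letter-nonempty (w′ 0)
  coordinates (suc k) with coordinates k
  ... | P , e , refl , e<ℓ with m≤n⇒m<n∨m≡n e<ℓ
  ...   | inj₁ 1+e<ℓ = P , suc e , sym (+-suc (Φ P) e) , 1+e<ℓ
  ...   | inj₂ 1+e≡ℓ = suc P , 0 , (begin
    suc (Φ P + e)                         ≡⟨ sym (+-suc (Φ P) e) ⟩
    Φ P + suc e                           ≡⟨ cong (Φ P +_) 1+e≡ℓ ⟩
    Φ P + length (φ-letter d₀ (w′ P))     ≡⟨ sym (Φ-suc P) ⟩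
    Φ (suc P)                             ≡⟨ sym (+-identityʳ _) ⟩
    Φ (suc P) + 0                         ∎) , φ-letter-nonempty (w′ (suc P))

  b-position : ∀ {k} → w k ≡ b → Σ ℕ λ P → w′ P ≡ a × k ≡ Φ P + d₀
  b-position {k} wk≡b with coordinates k
  ... | P , e , refl , e<ℓ = by-letter (w′ P) refl
    where
    letter : ∀ {c} → w′ P ≡ c → w (Φ P + e) ≡ at (φ-letter d₀ c) e
    letter refl = letter-in-block P e<ℓ
    e<ℓ′ : ∀ {c} → w′ P ≡ c → e < length (φ-letter d₀ c)
    e<ℓ′ refl = e<ℓ
    by-letter : ∀ c → w′ P ≡ c → Σ ℕ λ P′ → w′ P′ ≡ a × Φ P + e ≡ Φ P′ + d₀
    by-letter b w′P≡b with e<ℓ′ w′P≡b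
    ... | s≤s z≤n = ⊥-elim (b≢a (trans (sym wk≡b) (letter w′P≡b)))
    by-letter a w′P≡a with m≤n⇒m<n∨m≡n (s≤s⁻¹ (subst (e <_) length-φ-letter-a (e<ℓ′ w′P≡a)))
    ... | inj₂ refl = P , w′P≡a , refl
    ... | inj₁ e<d₀ = ⊥-elim (b≢a (trans (sym wk≡b) (trans (letter w′P≡a)
            (trans (at-++ˡ (a^ d₀) _ (subst (e <_) (sym (length-a^ d₀)) e<d₀)) (at-a^ d₀ e<d₀)))))

  b-followed-by-a : ∀ {k} → w k ≡ b → w (suc k) ≡ a
  b-followed-by-a wk≡b with b-position wk≡b
  ... | P , w′P≡a , refl = begin
    w (suc (Φ P + d₀))          ≡⟨ cong w next-block ⟩
    w (Φ (suc P) + 0)           ≡⟨ letter-in-block (suc P) (φ-letter-nonempty (w′ (suc P))) ⟩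
    at (φ-letter d₀ (w′ (suc P))) 0 ≡⟨ φ-letter-starts-with-a (w′ (suc P)) ⟩
    a                           ∎
    where
    next-block : suc (Φ P + d₀) ≡ Φ (suc P) + 0
    next-block = begin
      suc (Φ P + d₀)                        ≡⟨ sym (+-suc (Φ P) d₀) ⟩
      Φ P + suc d₀                          ≡⟨ cong (Φ P +_) (sym length-φ-letter-a) ⟩
      Φ P + length (φ-letter d₀ a)          ≡⟨ cong (λ c → Φ P + length (φ-letter d₀ c)) (sym w′P≡a) ⟩
      Φ P + length (φ-letter d₀ (w′ P))     ≡⟨ sym (trans (+-identityʳ _) (Φ-suc P)) ⟩
      Φ (suc P) + 0                         ∎

module Desubstitution (d : ℕ → ℕ) (d≥1 : ∀ i → d i ≥ 1) (w : ℕ → Letter) (w-char : IsCharWord d w) where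
  open Blocks d d≥1 w w-char public

  w′-b-followed-by-a : ∀ {P} → w′ P ≡ b → w′ (suc P) ≡ a
  w′-b-followed-by-a = Blocks.b-followed-by-a d′ d′≥1 w′ w′-char

  Φ-suc-a : ∀ {P} → w′ P ≡ a → Φ (suc P) ≡ Φ P + suc d₀
  Φ-suc-a {P} w′P≡a = trans (Φ-suc P) (trans (cong (λ c → Φ P + length (φ-letter d₀ c)) w′P≡a) (cong (Φ P +_) length-φ-letter-a))

  Φ-suc-b : ∀ {P} → w′ P ≡ b → Φ (suc P) ≡ suc (Φ P)
  Φ-suc-b {P} w′P≡b = trans (Φ-suc P) (trans (cong (λ c → Φ P + length (φ-letter d₀ c)) w′P≡b) (+-comm (Φ P) 1))

  prefix-block-a : ∀ {P} → w′ P ≡ a → prefix w (Φ P + suc d₀) ≡ φ d₀ (prefix w′ P) ++ a^ d₀ ++ b ∷ []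
  prefix-block-a {P} w′P≡a = begin
    prefix w (Φ P + suc d₀)                     ≡⟨ cong (prefix w) (sym (Φ-suc-a w′P≡a)) ⟩
    prefix w (Φ (suc P))                        ≡⟨ prefix-Φ (suc P) ⟩
    φ d₀ (prefix w′ (suc P))                    ≡⟨ φ-prefix-suc P ⟩
    φ d₀ (prefix w′ P) ++ φ-letter d₀ (w′ P)    ≡⟨ cong (λ c → φ d₀ (prefix w′ P) ++ φ-letter d₀ c) w′P≡a ⟩
    φ d₀ (prefix w′ P) ++ a^ d₀ ++ b ∷ []       ∎

  prefix-block-b : ∀ {P} → w′ P ≡ b → prefix w (Φ P + suc (suc d₀)) ≡ φ d₀ (prefix w′ P) ++ a^ (suc d₀) ++ b ∷ []
  prefix-block-b {P} w′P≡b = begin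
    prefix w (Φ P + suc (suc d₀))
      ≡⟨ cong (prefix w) (trans (+-suc (Φ P) (suc d₀)) (cong (_+ suc d₀) (sym (Φ-suc-b w′P≡b)))) ⟩
    prefix w (Φ (suc P) + suc d₀)
      ≡⟨ prefix-block-a (w′-b-followed-by-a w′P≡b) ⟩
    φ d₀ (prefix w′ (suc P)) ++ a^ d₀ ++ b ∷ []
      ≡⟨ cong (_++ a^ d₀ ++ b ∷ []) (trans (φ-prefix-suc P) (cong (λ c → φ d₀ (prefix w′ P) ++ φ-letter d₀ c) w′P≡b)) ⟩
    (φ d₀ (prefix w′ P) ++ a ∷ []) ++ a^ d₀ ++ b ∷ []
      ≡⟨ ++-assoc (φ d₀ (prefix w′ P)) (a ∷ []) _ ⟩
    φ d₀ (prefix w′ P) ++ a^ (suc d₀) ++ b ∷ [] ∎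

  nextB-a-block : ∀ {P} → w′ P ≡ a → NextB w (Φ P) (Φ P + d₀)
  nextB-a-block {P} w′P≡a = proj₁ (prefix-run w (φ d₀ (prefix w′ P)) d₀ (prefix-block-a w′P≡a))

  nextB-b-block : ∀ {P} → w′ P ≡ b → NextB w (Φ P) (Φ P + suc d₀)
  nextB-b-block {P} w′P≡b = proj₁ (prefix-run w (φ d₀ (prefix w′ P)) (suc d₀) (prefix-block-b w′P≡b))

  prefix-Φ+ : ∀ P {j} → j ≤ d₀ → prefix w (Φ P + j) ≡ φ d₀ (prefix w′ P) ++ a^ j
  prefix-Φ+ P {j} j≤d₀ with w′ P in w′P≡
  ... | a = proj₂ (prefix-run w (φ d₀ (prefix w′ P)) d₀ (prefix-block-a w′P≡)) j j≤d₀
  ... | b = proj₂ (prefix-run w (φ d₀ (prefix w′ P)) (suc d₀) (prefix-block-b w′P≡)) j (≤-trans j≤d₀ (n≤1+n d₀))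

  block-coordinates : ∀ k → Σ ℕ λ P → Σ ℕ λ e → k ≡ Φ P + e × ((w′ P ≡ a × e ≤ d₀) ⊎ (w′ P ≡ b × e ≡ 0))
  block-coordinates k with coordinates k
  ... | P , e , k≡ , e<ℓ = P , e , k≡ , by-letter (w′ P) refl
    where
    by-letter : ∀ c → w′ P ≡ c → (w′ P ≡ a × e ≤ d₀) ⊎ (w′ P ≡ b × e ≡ 0)
    by-letter a w′P≡a = inj₁ (w′P≡a , s≤s⁻¹ (subst (e <_) (trans (cong (λ c → length (φ-letter d₀ c)) w′P≡a) length-φ-letter-a) e<ℓ))
    by-letter b w′P≡b = inj₂ (w′P≡b , n<1⇒n≡0 (subst (e <_) (cong (λ c → length (φ-letter d₀ c)) w′P≡b) e<ℓ))

  Φ-<-suc : ∀ P → Φ P < Φ (suc P)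
  Φ-<-suc P = subst (Φ P <_) (sym (Φ-suc P)) (m<m+n (Φ P) (φ-letter-nonempty (w′ P)))

  Φ-mono-< : ∀ {P Q} → P < Q → Φ P < Φ Q
  Φ-mono-< {P} {suc Q} P<1+Q with m≤n⇒m<n∨m≡n (s≤s⁻¹ P<1+Q)
  ... | inj₁ P<Q  = <-trans (Φ-mono-< P<Q) (Φ-<-suc Q)
  ... | inj₂ refl = Φ-<-suc P

  Φ-cancel-≤ : ∀ {P Q} → Φ P ≤ Φ Q → P ≤ Q
  Φ-cancel-≤ ΦP≤ΦQ = ≮⇒≥ λ Q<P → <⇒≱ (Φ-mono-< Q<P) ΦP≤ΦQ

  suc-<-Φ-suc : ∀ P → suc P < Φ (suc P)
  suc-<-Φ-suc zero    = subst (1 <_) (sym (Φ-suc-a w′-0)) (s≤s (d≥1 0))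
  suc-<-Φ-suc (suc P) = ≤-<-trans (suc-<-Φ-suc P) (Φ-<-suc (suc P))

  palindrome-desubstitution : ∀ {P₁ P₂ x₀} → P₁ ≤ P₂ → x₀ ≤ d₀ → Φ P₁ + x₀ ≤ Φ P₂ + (d₀ ∸ x₀) →
    IsPalindrome (factor w (Φ P₁ + x₀) (Φ P₂ + (d₀ ∸ x₀))) → IsPalindrome (factor w′ P₁ P₂)
  palindrome-desubstitution {P₁} {P₂} {x₀} P₁≤P₂ x₀≤d₀ p₁≤p₂ pal =
    palindrome-of-φ d₀ v (subst IsPalindrome (++-cancelˡ pre _ _ (trans (sym via-w) via-w′))
                                             (palindrome-wrap (a^ x₀) u (reverse-a^ x₀) pal))
    where
    pre = φ d₀ (prefix w′ P₁)
    v = factor w′ P₁ P₂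
    u = factor w (Φ P₁ + x₀) (Φ P₂ + (d₀ ∸ x₀))
    via-w′ : prefix w (Φ P₂ + d₀) ≡ pre ++ φ d₀ v ++ a^ d₀
    via-w′ = begin
      prefix w (Φ P₂ + d₀)                         ≡⟨ prefix-Φ+ P₂ ≤-refl ⟩
      φ d₀ (prefix w′ P₂) ++ a^ d₀                 ≡⟨ cong (λ z → φ d₀ z ++ a^ d₀) (prefix-++-factor w′ P₁≤P₂) ⟩
      φ d₀ (prefix w′ P₁ ++ v) ++ a^ d₀            ≡⟨ cong (_++ a^ d₀) (φ-++ d₀ (prefix w′ P₁) v) ⟩
      (pre ++ φ d₀ v) ++ a^ d₀                     ≡⟨ ++-assoc pre (φ d₀ v) (a^ d₀) ⟩
      pre ++ φ d₀ v ++ a^ d₀                       ∎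
    via-w : prefix w (Φ P₂ + d₀) ≡ pre ++ a^ x₀ ++ u ++ a^ x₀
    via-w = begin
      prefix w (Φ P₂ + d₀)                                      ≡⟨ prefix-Φ+ P₂ ≤-refl ⟩
      φ d₀ (prefix w′ P₂) ++ a^ d₀                              ≡⟨ cong (λ n → φ d₀ (prefix w′ P₂) ++ a^ n) (sym (m∸n+n≡m x₀≤d₀)) ⟩
      φ d₀ (prefix w′ P₂) ++ a^ (d₀ ∸ x₀ + x₀)                  ≡⟨ cong (φ d₀ (prefix w′ P₂) ++_) (pow-+ (a ∷ []) (d₀ ∸ x₀) x₀) ⟩
      φ d₀ (prefix w′ P₂) ++ a^ (d₀ ∸ x₀) ++ a^ x₀              ≡⟨ sym (++-assoc (φ d₀ (prefix w′ P₂)) _ _) ⟩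
      (φ d₀ (prefix w′ P₂) ++ a^ (d₀ ∸ x₀)) ++ a^ x₀            ≡⟨ cong (_++ a^ x₀) (sym (prefix-Φ+ P₂ (m∸n≤m d₀ x₀))) ⟩
      prefix w (Φ P₂ + (d₀ ∸ x₀)) ++ a^ x₀                      ≡⟨ cong (_++ a^ x₀) (prefix-++-factor w p₁≤p₂) ⟩
      (prefix w (Φ P₁ + x₀) ++ u) ++ a^ x₀                      ≡⟨ cong (λ z → (z ++ u) ++ a^ x₀) (prefix-Φ+ P₁ x₀≤d₀) ⟩
      ((pre ++ a^ x₀) ++ u) ++ a^ x₀                            ≡⟨ cong (_++ a^ x₀) (++-assoc pre (a^ x₀) u) ⟩
      (pre ++ a^ x₀ ++ u) ++ a^ x₀                              ≡⟨ ++-assoc pre (a^ x₀ ++ u) (a^ x₀) ⟩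
      pre ++ (a^ x₀ ++ u) ++ a^ x₀                              ≡⟨ cong (pre ++_) (++-assoc (a^ x₀) u (a^ x₀)) ⟩
      pre ++ a^ x₀ ++ u ++ a^ x₀                                ∎

  represents-lift : ∀ {P n x x₀} → Represents d′ w′ P n x → x₀ ≤ d₀ → Represents d w (Φ P + x₀) (suc n) (prepend x₀ x)
  represents-lift {P} {n} {x} {x₀} (legal , eq) x₀≤d₀ = legal-prepend x₀≤d₀ legal , (begin
    prefix w (Φ P + x₀)                                                  ≡⟨ prefix-Φ+ P x₀≤d₀ ⟩
    φ d₀ (prefix w′ P) ++ a^ x₀                                          ≡⟨ cong (λ u → φ d₀ u ++ a^ x₀) eq ⟩
    φ d₀ (catDown (blocks d′ x) 0 (suc n)) ++ a^ x₀                      ≡⟨ cong (_++ a^ x₀) (φ-catDown-blocks d (prepend x₀ x) 0 (suc n)) ⟩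
    catDown (blocks d (prepend x₀ x)) 1 (suc n) ++ a^ x₀                 ≡⟨ sym (catDown-from-0 (blocks d (prepend x₀ x)) (suc n)) ⟩
    catDown (blocks d (prepend x₀ x)) 0 (suc (suc n))                    ∎)

  complementary-in-block : ∀ {P n x e f} → Represents d′ w′ P n x → e ≤ d₀ → f ≤ d₀ → ComplementaryRep d w (Φ P + e) (Φ P + f)
  complementary-in-block {P} {n} {x} {e} {f} rep e≤d₀ f≤d₀ =
    suc n , prepend e x , represents-lift {P} rep e≤d₀ , 0 , f , z≤n , (begin
      prefix w (Φ P + f)
        ≡⟨ prefix-Φ+ P f≤d₀ ⟩
      φ d₀ (prefix w′ P) ++ a^ f
        ≡⟨ cong₂ _++_ (trans (cong (φ d₀) (proj₂ rep)) (φ-catDown-blocks d (prepend e x) 0 (suc n)))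
                      (sym (++-identityʳ (a^ f))) ⟩
      catDown (blocks d (prepend e x)) 1 (suc n) ++ a^ f ++ [] ∎)

  lift : ∀ {P₁ P₂ x₀} → ComplementaryRep d′ w′ P₁ P₂ → x₀ ≤ d₀ → ComplementaryRep d w (Φ P₁ + x₀) (Φ P₂ + (d₀ ∸ x₀))
  lift {P₁} {P₂} {x₀} (n , x , rep , m , y , m≤n , eq) x₀≤d₀ =
    suc n , x⁺ , represents-lift {P₁} rep x₀≤d₀ , suc m , y , s≤s m≤n , (begin
      prefix w (Φ P₂ + (d₀ ∸ x₀))
        ≡⟨ prefix-Φ+ P₂ (m∸n≤m d₀ x₀) ⟩
      φ d₀ (prefix w′ P₂) ++ a^ (d₀ ∸ x₀)
        ≡⟨ cong (λ u → φ d₀ u ++ a^ (d₀ ∸ x₀)) eq ⟩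
      φ d₀ (top ++ mid ++ low) ++ a^ (d₀ ∸ x₀)
        ≡⟨ cong (_++ a^ (d₀ ∸ x₀)) (trans (φ-++ d₀ top _) (cong (φ d₀ top ++_) (φ-++ d₀ mid low))) ⟩
      (φ d₀ top ++ φ d₀ mid ++ φ d₀ low) ++ a^ (d₀ ∸ x₀)
        ≡⟨ trans (++-assoc (φ d₀ top) _ _) (cong (φ d₀ top ++_) (++-assoc (φ d₀ mid) _ _)) ⟩
      φ d₀ top ++ φ d₀ mid ++ φ d₀ low ++ a^ (d₀ ∸ x₀)
        ≡⟨ cong₂ _++_ (φ-catDown-blocks d x⁺ (suc m) (n ∸ m))
                      (cong₂ _++_ (φ-pow-std d m y) (cong (_++ a^ (d₀ ∸ x₀)) (φ-catDown-blocks d x̄⁺ 0 m))) ⟩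
      catDown (blocks d x⁺) (suc (suc m)) (n ∸ m) ++ pow (std d (suc m)) y ++ catDown (blocks d x̄⁺) 1 m ++ a^ (d₀ ∸ x₀)
        ≡⟨ cong (λ z → catDown (blocks d x⁺) (suc (suc m)) (n ∸ m) ++ pow (std d (suc m)) y ++ z) (sym (catDown-from-0 (blocks d x̄⁺) m)) ⟩
      catDown (blocks d x⁺) (suc (suc m)) (n ∸ m) ++ pow (std d (suc m)) y ++ catDown (blocks d x̄⁺) 0 (suc m) ∎)
    where
    x⁺ = prepend x₀ x
    x̄⁺ = λ i → d i ∸ x⁺ i
    top = catDown (blocks d′ x) (suc m) (n ∸ m)
    mid = pow (std d′ m) y
    low = catDown (blocks d′ (λ i → d′ i ∸ x i)) 0 m

-- Induction on p₂

PalindromeTheorem : ℕ → Set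
PalindromeTheorem p₂ = ∀ d → (∀ i → d i ≥ 1) → ∀ w → IsCharWord d w →
  ∀ p₁ → p₁ ≤ p₂ → IsPalindrome (factor w p₁ p₂) → ComplementaryRep d w p₁ p₂

module InductionStep (p₂ : ℕ) (ih : ∀ {p} → p < p₂ → PalindromeTheorem p)
                     (d : ℕ → ℕ) (d≥1 : ∀ i → d i ≥ 1) (w : ℕ → Letter) (w-char : IsCharWord d w)
                     (p₁ : ℕ) (p₁≤p₂ : p₁ ≤ p₂) (pal : IsPalindrome (factor w p₁ p₂)) where
  open Desubstitution d d≥1 w w-char

  u : List Letter
  u = factor w p₁ p₂

  p₁+|u| : p₁ + length u ≡ p₂
  p₁+|u| = trans (cong (p₁ +_) (length-factor w p₁ p₂)) (m+[n∸m]≡n p₁≤p₂)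

  below-p₂ : ∀ {P y} → 0 < P → p₂ ≡ Φ P + y → P < p₂
  below-p₂ {suc P} {y} _ p₂≡ = <-≤-trans (suc-<-Φ-suc P) (subst (Φ (suc P) ≤_) (sym p₂≡) (m≤m+n _ y))

  by-lifting : ∀ {P₁ P₂ x₀} → P₁ < P₂ → x₀ ≤ d₀ → p₁ ≡ Φ P₁ + x₀ → p₂ ≡ Φ P₂ + (d₀ ∸ x₀) → ComplementaryRep d w p₁ p₂
  by-lifting {P₁} {P₂} {x₀} P₁<P₂ x₀≤d₀ p₁≡ p₂≡ =
    subst₂ (ComplementaryRep d w) (sym p₁≡) (sym p₂≡)
      (lift {P₁} {P₂} (ih (below-p₂ (≤-<-trans z≤n P₁<P₂) p₂≡) d′ d′≥1 w′ w′-char P₁ (<⇒≤ P₁<P₂) pal′) x₀≤d₀)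
    where
    pal′ : IsPalindrome (factor w′ P₁ P₂)
    pal′ = palindrome-desubstitution (<⇒≤ P₁<P₂) x₀≤d₀ (subst₂ _≤_ p₁≡ p₂≡ p₁≤p₂)
             (subst₂ (λ p q → IsPalindrome (factor w p q)) p₁≡ p₂≡ pal)

  -- The digits of a prefix come from the induction hypothesis for an empty palindrome.
  prefix-representation : ∀ P → Φ P ≤ p₂ → Σ ℕ λ n → Σ (ℕ → ℕ) λ x → Represents d′ w′ P n x
  prefix-representation zero    _       = 0 , (λ _ → 0) , (λ _ _ → z≤n) , refl
  prefix-representation (suc P) ΦP≤p₂ with ih (<-≤-trans (suc-<-Φ-suc P) ΦP≤p₂) d′ d′≥1 w′ w′-char (suc P) ≤-refl
                                             (subst IsPalindrome (sym (factor-self w′ (suc P))) refl)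
  ... | n , x , rep , _ = n , x , rep

  by-block : ∀ {P e} → p₁ ≡ Φ P + e → e ≤ d₀ → p₂ ≤ Φ P + d₀ → ComplementaryRep d w p₁ p₂
  by-block {P} {e} p₁≡ e≤d₀ p₂≤ =
    subst₂ (ComplementaryRep d w) (sym p₁≡) (m+[n∸m]≡n ΦP≤p₂)
      (complementary-in-block {P} (proj₂ (proj₂ (prefix-representation P ΦP≤p₂))) e≤d₀ (m≤n+o⇒m∸n≤o p₂ (Φ P) p₂≤))
    where
    ΦP≤p₂ : Φ P ≤ p₂
    ΦP≤p₂ = ≤-trans (subst (Φ P ≤_) (sym p₁≡) (m≤m+n (Φ P) e)) p₁≤p₂

  a-run-of-u : ∀ {L} → u ≡ a^ L → aRun w p₁ p₂
  a-run-of-u {L} u≡ = aRun-of-factor w {p₁} {p₂} [] [] (trans u≡ (sym (++-identityʳ (a^ L)))) (+-identityʳ p₁)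
    (trans (cong (p₁ +_) (trans (sym (length-a^ L)) (cong length (sym u≡)))) p₁+|u|)

  a-block-without-b : ∀ {P e L} → p₁ ≡ Φ P + e → w′ P ≡ a → e ≤ d₀ → u ≡ a^ L → ComplementaryRep d w p₁ p₂
  a-block-without-b {P} {e} {L} p₁≡ w′P≡a e≤d₀ u≡ =
    by-block {P} p₁≡ e≤d₀ (aRun-bound w (a-run-of-u {L} u≡) p₁≤ (proj₂ (proj₂ (nextB-a-block w′P≡a))))
    where
    p₁≤ : p₁ ≤ Φ P + d₀
    p₁≤ = subst (_≤ Φ P + d₀) (sym p₁≡) (+-monoʳ-≤ (Φ P) e≤d₀)

  b-block-without-b : ∀ {P L} → p₁ ≡ Φ P + 0 → w′ P ≡ b → u ≡ a^ L → ComplementaryRep d w p₁ p₂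
  b-block-without-b {P} {L} p₁≡ w′P≡b u≡ with p₂ ≤? Φ P + d₀
  ... | yes p₂≤ = by-block {P} p₁≡ z≤n p₂≤
  ... | no p₂≰ = by-lifting {P} {suc P} {0} ≤-refl z≤n p₁≡ p₂≡
    where
    p₂≤ : p₂ ≤ Φ P + suc d₀
    p₂≤ = aRun-bound w (a-run-of-u {L} u≡) (subst (_≤ Φ P + suc d₀) (sym p₁≡) (+-monoʳ-≤ (Φ P) z≤n))
                     (proj₂ (proj₂ (nextB-b-block w′P≡b)))
    p₂≡ : p₂ ≡ Φ (suc P) + d₀
    p₂≡ = trans (≤-antisym (subst (p₂ ≤_) (+-suc (Φ P) d₀) p₂≤) (≰⇒> p₂≰)) (cong (_+ d₀) (sym (Φ-suc-b w′P≡b)))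

  module WithB (i : ℕ) (v : List Letter) (u≡ : u ≡ a^ i ++ b ∷ v) where

    mirrored : u ≡ reverse v ++ b ∷ a^ i
    mirrored = begin
      u                                   ≡⟨ sym pal ⟩
      reverse u                           ≡⟨ cong reverse u≡ ⟩
      reverse (a^ i ++ b ∷ v)             ≡⟨ reverse-++ (a^ i) (b ∷ v) ⟩
      reverse (b ∷ v) ++ reverse (a^ i)   ≡⟨ cong₂ _++_ (unfold-reverse b v) (reverse-a^ i) ⟩
      (reverse v ++ b ∷ []) ++ a^ i       ≡⟨ ++-assoc (reverse v) (b ∷ []) (a^ i) ⟩
      reverse v ++ b ∷ a^ i               ∎

    first-b : NextB w p₁ (p₁ + i)
    first-b = m≤m+n p₁ i , aRun-of-factor w {p₁} {p₂} [] (b ∷ v) u≡ (+-identityʳ p₁) refl ,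
              letter-of-factor w {p₁} {p₂} (a^ i) v u≡ (cong (p₁ +_) (length-a^ i))

    last : ℕ
    last = p₁ + length v

    last-b : w last ≡ b
    last-b = letter-of-factor w {p₁} {p₂} (reverse v) (a^ i) mirrored (cong (p₁ +_) (length-reverse v))

    last+1+i : suc last + i ≡ p₂
    last+1+i = begin
      suc last + i                  ≡⟨ sym (+-suc last i) ⟩
      last + suc i                  ≡⟨ +-assoc p₁ (length v) (suc i) ⟩
      p₁ + (length v + suc i)       ≡⟨ cong (p₁ +_) (sym |u|) ⟩
      p₁ + length u                 ≡⟨ p₁+|u| ⟩
      p₂                            ∎
      where
      |u| : length u ≡ length v + suc i
      |u| = trans (cong length mirrored) (trans (length-++ (reverse v)) (cong₂ (λ m n → m + suc n) (length-reverse v) (length-a^ i)))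

    trailing-run : aRun w (suc last) p₂
    trailing-run = aRun-of-factor w {p₁} {p₂} (reverse v ++ b ∷ []) [] mirrored′ position last+1+i
      where
      mirrored′ : u ≡ (reverse v ++ b ∷ []) ++ a^ i ++ []
      mirrored′ = trans mirrored (trans (cong (λ z → reverse v ++ b ∷ z) (sym (++-identityʳ (a^ i))))
                                        (sym (++-assoc (reverse v) (b ∷ []) _)))
      position : p₁ + length (reverse v ++ b ∷ []) ≡ suc last
      position = trans (cong (p₁ +_) (trans (length-++ (reverse v)) (trans (cong (_+ 1) (length-reverse v)) (+-comm (length v) 1))))
                       (+-suc p₁ (length v))

    Q : ℕ
    Q = proj₁ (b-position last-b)

    w′Q≡a : w′ Q ≡ a
    w′Q≡a = proj₁ (proj₂ (b-position last-b))

    last≡ : last ≡ Φ Q + d₀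
    last≡ = proj₂ (proj₂ (b-position last-b))

    after-last : suc last ≡ Φ (suc Q)
    after-last = trans (cong suc last≡) (trans (sym (+-suc (Φ Q) d₀)) (sym (Φ-suc-a w′Q≡a)))

    p₂≡ : p₂ ≡ Φ (suc Q) + i
    p₂≡ = trans (sym last+1+i) (cong (_+ i) after-last)

    first-b-at : ∀ {P e g} → p₁ ≡ Φ P + e → e ≤ g → NextB w (Φ P) (Φ P + g) → p₁ + i ≡ Φ P + g
    first-b-at {P} {e} {g} p₁≡ e≤g next = nextB-unique w first-b (nextB-later w ΦP≤p₁ p₁≤ next)
      where
      ΦP≤p₁ : Φ P ≤ p₁
      ΦP≤p₁ = subst (Φ P ≤_) (sym p₁≡) (m≤m+n (Φ P) e)
      p₁≤ : p₁ ≤ Φ P + g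
      p₁≤ = subst (_≤ Φ P + g) (sym p₁≡) (+-monoʳ-≤ (Φ P) e≤g)

    offset : ∀ {P e g} → p₁ ≡ Φ P + e → p₁ + i ≡ Φ P + g → e + i ≡ g
    offset {P} {e} {g} p₁≡ first≡ =
      +-cancelˡ-≡ (Φ P) (e + i) g (trans (sym (+-assoc (Φ P) e i)) (trans (cong (_+ i) (sym p₁≡)) first≡))

    block-≤-Q : ∀ {P g} → d₀ ≤ g → p₁ + i ≡ Φ P + g → P ≤ Q
    block-≤-Q {P} {g} d₀≤g first≡ = Φ-cancel-≤ (+-cancelʳ-≤ d₀ (Φ P) (Φ Q)
      (≤-trans (+-monoʳ-≤ (Φ P) d₀≤g) (subst₂ _≤_ first≡ last≡ (aRun-bound w (proj₁ (proj₂ first-b)) (m≤m+n p₁ _) last-b))))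

    a-block : ∀ {P e} → p₁ ≡ Φ P + e → w′ P ≡ a → e ≤ d₀ → ComplementaryRep d w p₁ p₂
    a-block {P} {e} p₁≡ w′P≡a e≤d₀ =
      by-lifting {P} {suc Q} {e} (s≤s (block-≤-Q {P} ≤-refl first≡)) e≤d₀ p₁≡ (trans p₂≡ (cong (Φ (suc Q) +_) i≡))
      where
      first≡ : p₁ + i ≡ Φ P + d₀
      first≡ = first-b-at {P} p₁≡ e≤d₀ (nextB-a-block w′P≡a)
      i≡ : i ≡ d₀ ∸ e
      i≡ = trans (sym (m+n∸m≡n e i)) (cong (_∸ e) (offset {P} p₁≡ first≡))

    b-block : ∀ {P} → p₁ ≡ Φ P + 0 → w′ P ≡ b → ComplementaryRep d w p₁ p₂
    b-block {P} p₁≡ w′P≡b with w′ (suc Q) in w′Q+1≡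
    ... | a = ⊥-elim (<⇒≱ (+-monoʳ-< (Φ (suc Q)) ≤-refl) (subst (_≤ Φ (suc Q) + d₀) p₂≡′
                (aRun-bound w run (m≤m+n (Φ (suc Q)) d₀) (proj₂ (proj₂ (nextB-a-block w′Q+1≡))))))
      where
      run : aRun w (Φ (suc Q)) p₂
      run = subst (λ s → aRun w s p₂) after-last trailing-run
      p₂≡′ : p₂ ≡ Φ (suc Q) + suc d₀
      p₂≡′ = trans p₂≡ (cong (Φ (suc Q) +_) (offset {P} p₁≡ first≡))
        where first≡ = first-b-at {P} p₁≡ z≤n (nextB-b-block w′P≡b)
    ... | b = by-lifting {P} {suc (suc Q)} {0} (s≤s (≤-trans (block-≤-Q {P} (n≤1+n d₀) first≡) (n≤1+n Q))) z≤n p₁≡ (begin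
      p₂                              ≡⟨ p₂≡ ⟩
      Φ (suc Q) + i                   ≡⟨ cong (Φ (suc Q) +_) (offset {P} p₁≡ first≡) ⟩
      Φ (suc Q) + suc d₀              ≡⟨ +-suc (Φ (suc Q)) d₀ ⟩
      suc (Φ (suc Q)) + d₀            ≡⟨ cong (_+ d₀) (sym (Φ-suc-b w′Q+1≡)) ⟩
      Φ (suc (suc Q)) + d₀            ∎)
      where
      first≡ : p₁ + i ≡ Φ P + suc d₀
      first≡ = first-b-at {P} p₁≡ z≤n (nextB-b-block w′P≡b)

  complementary : ComplementaryRep d w p₁ p₂
  complementary with block-coordinates p₁ | split-at-first-b u
  ... | P , e , p₁≡ , inj₁ (w′P≡a , e≤d₀) | inj₁ (L , u≡)     = a-block-without-b {P} {e} {L} p₁≡ w′P≡a e≤d₀ u≡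
  ... | P , _ , p₁≡ , inj₂ (w′P≡b , refl) | inj₁ (L , u≡)     = b-block-without-b {P} {L} p₁≡ w′P≡b u≡
  ... | P , e , p₁≡ , inj₁ (w′P≡a , e≤d₀) | inj₂ (i , v , u≡) = WithB.a-block i v u≡ {P} p₁≡ w′P≡a e≤d₀
  ... | P , _ , p₁≡ , inj₂ (w′P≡b , refl) | inj₂ (i , v , u≡) = WithB.b-block i v u≡ {P} p₁≡ w′P≡b

palindrome-theorem : ∀ p₂ → PalindromeTheorem p₂
palindrome-theorem = <-rec PalindromeTheorem λ p₂ ih d d≥1 w w-char p₁ p₁≤p₂ pal →
  InductionStep.complementary p₂ ih d d≥1 w w-char p₁ p₁≤p₂ pal

length-catDown-blocks : ∀ d x lo k → length (catDown (blocks d x) lo k) ≡ sumFrom (λ i → x i * q d i) lo k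
length-catDown-blocks d x lo zero    = refl
length-catDown-blocks d x lo (suc k) = trans (length-++ (blocks d x (lo + k)))
  (cong₂ _+_ (length-pow (std d (lo + k)) (x (lo + k))) (length-catDown-blocks d x lo k))

mainTheorem3 : (d : ℕ → ℕ) → (∀ i → d i ≥ 1) →
    (w : ℕ → Letter) → IsCharWord d w →
    (p₁ p₂ : ℕ) → p₁ ≤ p₂ → IsPalindrome (factor w p₁ p₂) →
    Σ ℕ λ n → Σ (ℕ → ℕ) λ x →
      (∀ i → i ≤ n → x i ≤ d i) ×
      (p₁ ≡ sumFrom (λ i → x i * q d i) 0 (suc n)) ×
      Σ ℕ λ m → Σ ℕ λ y → m ≤ n ×
        (p₂ ≡ sumFrom (λ i → x i * q d i) (suc m) (n ∸ m)
              + y * q d m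
              + sumFrom (λ i → (d i ∸ x i) * q d i) 0 m) ×
        (prefix w p₂ ≡ catDown (λ i → pow (std d i) (x i)) (suc m) (n ∸ m)
                       ++ pow (std d m) y
                       ++ catDown (λ i → pow (std d i) (d i ∸ x i)) 0 m)
mainTheorem3 d d≥1 w w-char p₁ p₂ p₁≤p₂ pal with palindrome-theorem p₂ d d≥1 w w-char p₁ p₁≤p₂ pal
... | n , x , (legal , prefix-p₁) , m , y , m≤n , prefix-p₂ = n , x , legal , p₁≡ , m , y , m≤n , p₂≡ , prefix-p₂
  where
  x̄ = λ i → d i ∸ x i
  p₁≡ : p₁ ≡ sumFrom (λ i → x i * q d i) 0 (suc n)
  p₁≡ = trans (sym (length-prefix w p₁)) (trans (cong length prefix-p₁) (length-catDown-blocks d x 0 (suc n)))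
  p₂≡ : p₂ ≡ sumFrom (λ i → x i * q d i) (suc m) (n ∸ m) + y * q d m + sumFrom (λ i → x̄ i * q d i) 0 m
  p₂≡ = begin
    p₂
      ≡⟨ sym (length-prefix w p₂) ⟩
    length (prefix w p₂)
      ≡⟨ cong length prefix-p₂ ⟩
    length (catDown (blocks d x) (suc m) (n ∸ m) ++ pow (std d m) y ++ catDown (blocks d x̄) 0 m)
      ≡⟨ trans (length-++ (catDown (blocks d x) (suc m) (n ∸ m))) (cong (length (catDown (blocks d x) (suc m) (n ∸ m)) +_) (length-++ (pow (std d m) y))) ⟩
    length (catDown (blocks d x) (suc m) (n ∸ m)) + (length (pow (std d m) y) + length (catDown (blocks d x̄) 0 m))
      ≡⟨ cong₂ _+_ (length-catDown-blocks d x (suc m) (n ∸ m)) (cong₂ _+_ (length-pow (std d m) y) (length-catDown-blocks d x̄ 0 m)) ⟩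
    sumFrom (λ i → x i * q d i) (suc m) (n ∸ m) + (y * q d m + sumFrom (λ i → x̄ i * q d i) 0 m)
      ≡⟨ sym (+-assoc (sumFrom (λ i → x i * q d i) (suc m) (n ∸ m)) _ _) ⟩
    sumFrom (λ i → x i * q d i) (suc m) (n ∸ m) + y * q d m + sumFrom (λ i → x̄ i * q d i) 0 m ∎
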